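{- Every graph $G$ satisfies $\mathsf{si}(G)\le \mathsf{pw}(G)^2+\mathsf{pw}(G)$.
   Context: All graphs are finite, simple, non-empty and undirected. $\mathsf{pw}(G)$ denotes the pathwidth of $G$. For an integer $d\ge 0$, a $d$-simultaneous interval representation of a graph $G$ is a pair $(R,L)$ where $R$ assigns to each vertex $v$ an open interval $R(v)$ of the real line and $L$ assigns to each vertex a (possibly empty) subset $L(v)\subseteq\{1,\dots,d\}$, such that for any two distinct vertices $u,v$: $uv\in E(G)$ if and only if $R(u)\cap R(v)\neq\emptyset$ and $L(u)\cap L(v)\neq\emptyset$. The simultaneous interval number $\mathsf{si}(G)$ is the smallest $d$ such that $G$ has such a representation. -}

module Defs where

open import Data.Nat using (ℕ; suc; _≤_)
open import Data.Bool using (Bool; true)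
open import Data.Fin using (Fin; toℕ)
open import Data.Fin.Subset using (Subset; _∈_; ∣_∣)
open import Data.Rational using (ℚ; _<_)
open import Data.Product using (Σ; ∃; ∃-syntax; _×_)
open import Relation.Binary.PropositionalEquality using (_≡_; _≢_)
open import Function.Bundles using (_⇔_)
import Data.Empty

record Graph : Set where
  field
    n       : ℕ
    nonEmpty : 1 ≤ n
    adj     : Fin n → Fin n → Bool
    adj-sym : ∀ u v → adj u v ≡ adj v u
    irrefl  : ∀ v → adj v v ≡ true → Data.Empty.⊥
open Graph public

Edge : (G : Graph) → Fin (n G) → Fin (n G) → Set
Edge G u v = adj G u v ≡ true

record PathDecomposition (G : Graph) : Set where
  field
    m          : ℕ
    bag        : Fin m → Subset (n G)
    covers-vtx : ∀ v → ∃[ i ] (v ∈ bag i)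
    covers-edge : ∀ u v → Edge G u v → ∃[ i ] (u ∈ bag i × v ∈ bag i)
    contiguous : ∀ v (i j k : Fin m) → toℕ i ≤ toℕ j → toℕ j ≤ toℕ k →
                 v ∈ bag i → v ∈ bag k → v ∈ bag j
open PathDecomposition public

HasPathDecompOfWidth≤ : Graph → ℕ → Set
HasPathDecompOfWidth≤ G w =
  Σ (PathDecomposition G) λ P → ∀ i → ∣ bag P i ∣ ≤ suc w

IsPathwidth : Graph → ℕ → Set
IsPathwidth G k = HasPathDecompOfWidth≤ G k × (∀ j → HasPathDecompOfWidth≤ G j → k ≤ j)

-- An open interval (a , b) of the line with a < b, endpoints rational
-- (equivalent to real endpoints for finite graphs).
record OpenInterval : Set where
  constructor ⟨_,_,_⟩
  field
    lo  : ℚ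
    hi  : ℚ
    lo<hi : lo < hi
open OpenInterval public

_∈ᵢ_ : ℚ → OpenInterval → Set
q ∈ᵢ I = lo I < q × q < hi I

IntervalsMeet : OpenInterval → OpenInterval → Set
IntervalsMeet I J = ∃[ q ] (q ∈ᵢ I × q ∈ᵢ J)

-- L(v) ⊆ {1,…,d} is modelled as a subset of Fin d.
LabelsMeet : ∀ {d} → Subset d → Subset d → Set
LabelsMeet {d} A B = ∃[ c ] (c ∈ A × c ∈ B)

record SimIntervalRep (G : Graph) (d : ℕ) : Set where
  field
    R : Fin (n G) → OpenInterval
    L : Fin (n G) → Subset d
    correct : ∀ u v → u ≢ v →
              Edge G u v ⇔ (IntervalsMeet (R u) (R v) × LabelsMeet (L u) (L v))

si≤ : Graph → ℕ → Set
si≤ G b = ∃[ d ] (d ≤ b × SimIntervalRep G d)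

{-# OPTIONS --safe #-}
-- Order the vertices by their first bag. A vertex and its earlier neighbours in that bag
-- lie in one bag of size at most k + 1, so greedy colouring with k + 1 colours properly
-- colours the interval graph of the decomposition, and every vertex has at most one earlier
-- interval-neighbour of each colour. Each vertex v then receives one bit σ_v(c) per colour c,
-- chosen along the order so that for interval-adjacent u, v the pair uv is an edge of G
-- exactly when σ_u(colour v) ≠ σ_v(colour u). The k (k + 1) labels are the ordered pairs
-- (p , q) of distinct colours: v carries (p , q) when colour v = p and σ_v(q) = true, or
-- colour v = q and σ_v(p) = false. Two vertices of different colours then share a label
-- exactly when their bits towards each other differ, and the intervals spanned by the
-- bags of v take care of the remaining condition.
module Submission where

open import Defs
open import Data.Nat using (ℕ; _+_; _*_)

open import Data.Bool as Bool using (Bool; true; false; _xor_)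
open import Data.Bool.Properties using (not-¬)
open import Data.Fin as Fin using (Fin; zero; suc; toℕ; combine; remQuot; punchIn; punchOut)
import Data.Fin.Induction as FinI
import Data.Fin.Properties as FinP
open import Data.Fin.Subset using (Subset; _∈_; ∣_∣; _-_)
open import Data.Fin.Subset.Properties using (_∈?_; x∈p∧x≢y⇒x∈p-y; x∈p⇒∣p-x∣<∣p∣)
open import Data.Integer as ℤ using (+_; +<+; +≤+)
import Data.Integer.Properties as ℤP
open import Data.Maybe using (Maybe; just; nothing; maybe)
import Data.Maybe.Properties as MaybeP
open import Data.Nat using (zero; suc; _≤_; _<_; z≤n; s≤s)
import Data.Nat.Properties as ℕP
open import Data.Product using (∃; ∃-syntax; _×_; _,_; proj₁; proj₂; map₂; swap; uncurry)
open import Data.Rational as ℚ using (ℚ; *<*; *≤*)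
import Data.Rational.Properties as ℚP
open import Data.Rational.Literals using (fromℤ)
open import Data.Sum using (_⊎_; inj₁; inj₂)
open import Data.Vec using (Vec; lookup; tabulate)
open import Data.Vec.Properties using (lookup∘tabulate; tabulate-cong; []=⇒lookup; lookup⇒[]=)
open import Function using (_∘_)
open import Function.Bundles using (_⇔_; mk⇔; Equivalence)
open import Function.Construct.Composition using (_⇔-∘_)
open import Function.Construct.Symmetry using (⇔-sym)
open import Function.Definitions using (Injective)
open import Induction.WellFounded using (WellFounded; module All; module FixPoint; module Subrelation; wf⇒asym)
open import Relation.Binary.Core using (Rel)
import Relation.Binary.Construct.On as On
open import Relation.Binary.Definitions using (Decidable; tri<; tri≈; tri>)
open import Relation.Binary.PropositionalEquality
open import Relation.Nullary using (¬_; Dec; yes; no; does; contradiction)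
open import Relation.Nullary.Decidable using (dec-true; decidable-stable; _×-dec_; _⊎-dec_; ¬?)
open import Relation.Unary as U using (Pred)

∈-tabulate-does : ∀ {n p} {P : Pred (Fin n) p} (P? : U.Decidable P) {i} →
                  i ∈ tabulate (does ∘ P?) ⇔ P i
∈-tabulate-does {P = P} P? {i} = mk⇔
  (λ i∈ → dec-true⁻¹ (P? i) (trans (sym (lookup∘tabulate _ i)) ([]=⇒lookup i∈)))
  (λ Pi → lookup⇒[]= i _ (trans (lookup∘tabulate _ i) (dec-true (P? i) Pi)))
  where
  dec-true⁻¹ : (Pi? : Dec (P i)) → does Pi? ≡ true → P i
  dec-true⁻¹ (yes Pi) _ = Pi
  dec-true⁻¹ (no _)   ()

injection⇒≤∣p∣ : ∀ {r n} {p : Subset n} (f : Fin r → Fin n) →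
                 Injective _≡_ _≡_ f → (∀ i → f i ∈ p) → r ≤ ∣ p ∣
injection⇒≤∣p∣ {zero}  f _ _ = z≤n
injection⇒≤∣p∣ {suc r} {p = p} f f-inj f∈p =
  ℕP.≤-trans (s≤s (injection⇒≤∣p∣ (f ∘ suc) (FinP.suc-injective ∘ f-inj) f∘suc∈p-f₀))
             (x∈p⇒∣p-x∣<∣p∣ (f∈p zero))
  where
  f∘suc∈p-f₀ : ∀ i → f (suc i) ∈ p - f zero
  f∘suc∈p-f₀ i = x∈p∧x≢y⇒x∈p-y (f∈p (suc i)) (λ fᵢ≡f₀ → FinP.0≢1+n (sym (f-inj fᵢ≡f₀)))

least : ∀ {m p} {P : Pred (Fin m) p} → U.Decidable P → ∃ P →
        ∃[ i ] P i × (∀ {j} → P j → i Fin.≤ j)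
least {suc m} P? (i , Pi) with P? zero
... | yes P₀ = zero , P₀ , λ _ → z≤n
least {suc m} P? (zero , P₀) | no ¬P₀ = contradiction P₀ ¬P₀
least {suc m} P? (suc i , Pi) | no ¬P₀ with least (P? ∘ suc) (i , Pi)
... | j , Pj , j-min = suc j , Pj , λ { {zero} P₀ → contradiction P₀ ¬P₀ ; {suc l} Pl → s≤s (j-min Pl) }

greatest : ∀ {m p} {P : Pred (Fin m) p} → U.Decidable P → ∃ P →
           ∃[ i ] P i × (∀ {j} → P j → j Fin.≤ i)
greatest {suc m} P? (i , Pi) with FinP.any? (P? ∘ suc)
... | yes ∃P∘suc with greatest (P? ∘ suc) ∃P∘suc
...   | j , Pj , j-max = suc j , Pj , λ { {zero} _ → z≤n ; {suc l} Pl → s≤s (j-max Pl) }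
greatest {suc m} P? (zero , P₀) | no ∄P∘suc =
  zero , P₀ , λ { {zero} _ → z≤n ; {suc l} Pl → contradiction (l , Pl) ∄P∘suc }
greatest {suc m} P? (suc i , Pi) | no ∄P∘suc = contradiction (i , Pi) ∄P∘suc

fromℕ : ℕ → ℚ
fromℕ n = fromℤ (+ n)

fromℕ-mono-≤ : ∀ {m n} → m ≤ n → fromℕ m ℚ.≤ fromℕ n
fromℕ-mono-≤ {m} {n} m≤n =
  *≤* (subst₂ ℤ._≤_ (sym (ℤP.*-identityʳ (+ m))) (sym (ℤP.*-identityʳ (+ n))) (+≤+ m≤n))

fromℕ-mono-< : ∀ {m n} → m < n → fromℕ m ℚ.< fromℕ n
fromℕ-mono-< {m} {n} m<n =
  *<* (subst₂ ℤ._<_ (sym (ℤP.*-identityʳ (+ m))) (sym (ℤP.*-identityʳ (+ n))) (+<+ m<n))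

fromℕ-cancel-< : ∀ {m n} → fromℕ m ℚ.< fromℕ n → m < n
fromℕ-cancel-< {m} {n} m<n =
  ℤP.drop‿+<+ (subst₂ ℤ._<_ (ℤP.*-identityʳ (+ m)) (ℤP.*-identityʳ (+ n)) (ℚP.drop-*<* m<n))

xor⇒≡true⇔≢ : ∀ {a b c} → c ≡ a xor b → a ≡ true ⇔ b ≢ c
xor⇒≡true⇔≢ {true}  refl = mk⇔ (λ _ → not-¬ refl) (λ _ → refl)
xor⇒≡true⇔≢ {false} refl = mk⇔ (λ ()) (λ b≢b → contradiction refl b≢b)

module CourseOfValues {n ℓ} {_≺_ : Rel (Fin n) ℓ} (_≺?_ : Decidable _≺_)
                      (≺-wf : WellFounded _≺_) {a} {A : Set a} where

  visible : ∀ {u v} → Dec (u ≺ v) → (u ≺ v → A) → Maybe A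
  visible (yes u≺v) x = just (x u≺v)
  visible (no _)    _ = nothing

  earlier : (Fin n → A) → Fin n → Vec (Maybe A) n
  earlier f v = tabulate λ u → visible (u ≺? v) λ _ → f u

  lookup-earlier : ∀ f {u v} → u ≺ v → lookup (earlier f v) u ≡ just (f u)
  lookup-earlier f {u} {v} u≺v = trans (lookup∘tabulate _ u) (visible-yes (u ≺? v))
    where
    visible-yes : (u≺?v : Dec (u ≺ v)) → visible u≺?v (λ _ → f u) ≡ just (f u)
    visible-yes (yes _)  = refl
    visible-yes (no u⊀v) = contradiction u≺v u⊀v

  lookup-earlier⁻¹ : ∀ f {u v x} → lookup (earlier f v) u ≡ just x → u ≺ v × f u ≡ x
  lookup-earlier⁻¹ f {u} {v} {x} eq = visible-just (u ≺? v) (trans (sym (lookup∘tabulate _ u)) eq)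
    where
    visible-just : (u≺?v : Dec (u ≺ v)) → visible u≺?v (λ _ → f u) ≡ just x → u ≺ v × f u ≡ x
    visible-just (yes u≺v) refl = u≺v , refl
    visible-just (no _)    ()

  module _ (step : Fin n → Vec (Maybe A) n → A) where

    private
      step′ : ∀ v → (∀ {u} → u ≺ v → A) → A
      step′ v IH = step v (tabulate λ u → visible (u ≺? v) IH)

      step′-ext : ∀ v {IH IH′ : ∀ {u} → u ≺ v → A} →
                  (∀ {u} (u≺v : u ≺ v) → IH u≺v ≡ IH′ u≺v) → step′ v IH ≡ step′ v IH′
      step′-ext v {IH} {IH′} IH≗IH′ = cong (step v) (tabulate-cong λ u → visible-cong (u ≺? v))
        where
        visible-cong : ∀ {u} (u≺?v : Dec (u ≺ v)) → visible u≺?v IH ≡ visible u≺?v IH′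
        visible-cong (yes u≺v) = cong just (IH≗IH′ u≺v)
        visible-cong (no _)    = refl

    -- Abstract so that type checking never unfolds the well-founded recursion.
    abstract
      recurse : Fin n → A
      recurse = All.wfRec ≺-wf a (λ _ → A) step′

      recurse-unfold : ∀ v → recurse v ≡ step v (earlier recurse v)
      recurse-unfold v = FixPoint.unfold-wfRec ≺-wf (λ _ → A) step′ step′-ext

module GreedyColouring {n k ℓ} {_≺_ : Rel (Fin n) ℓ} (_≺?_ : Decidable _≺_)
  (≺-wf : WellFounded _≺_) (home : Fin n → Subset n) (∈-home : ∀ v → v ∈ home v)
  (≺⇒∈-home : ∀ {u v} → u ≺ v → u ∈ home v) (∣home∣≤ : ∀ v → ∣ home v ∣ ≤ suc k) where

  open CourseOfValues _≺?_ ≺-wf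

  Taken : Vec (Maybe (Fin (suc k))) n → Fin (suc k) → Set
  Taken cs c = ∃[ u ] lookup cs u ≡ just c

  taken? : ∀ cs → U.Decidable (Taken cs)
  taken? cs c = FinP.any? λ u → MaybeP.≡-dec FinP._≟_ (lookup cs u) (just c)

  -- Defaults to zero when every colour is taken, which never happens below.
  freeColour : Vec (Maybe (Fin (suc k))) n → Fin (suc k)
  freeColour cs with FinP.any? (¬? ∘ taken? cs)
  ... | yes (c , _) = c
  ... | no _        = zero

  freeColour-free : ∀ cs → (∀ c → Taken cs c) ⊎ ¬ Taken cs (freeColour cs)
  freeColour-free cs with FinP.any? (¬? ∘ taken? cs)
  ... | yes (_ , c-free) = inj₂ c-free
  ... | no ∄free = inj₁ λ c → decidable-stable (taken? cs c) (λ c-free → ∄free (c , c-free))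

  colour : Fin n → Fin (suc k)
  colour = recurse λ _ → freeColour

  ≺-irrefl : ∀ {v} → ¬ v ≺ v
  ≺-irrefl v≺v = wf⇒asym ≺-wf v≺v v≺v

  -- One earlier vertex of each colour, together with v itself, would overfill home v.
  not-all-taken : ∀ v → ¬ (∀ c → Taken (earlier colour v) c)
  not-all-taken v all-taken = ℕP.<-irrefl refl (begin-strict
    suc k            ≤⟨ injection⇒≤∣p∣ witness witness-injective witness∈home-v ⟩
    ∣ home v - v ∣   <⟨ x∈p⇒∣p-x∣<∣p∣ (∈-home v) ⟩
    ∣ home v ∣       ≤⟨ ∣home∣≤ v ⟩
    suc k            ∎)
    where
    open ℕP.≤-Reasoning
    witness : Fin (suc k) → Fin n
    witness c = proj₁ (all-taken c)
    witness-spec : ∀ c → witness c ≺ v × colour (witness c) ≡ c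
    witness-spec c = lookup-earlier⁻¹ colour (proj₂ (all-taken c))
    witness-injective : Injective _≡_ _≡_ witness
    witness-injective {c} {c′} eq =
      trans (sym (proj₂ (witness-spec c))) (trans (cong colour eq) (proj₂ (witness-spec c′)))
    witness∈home-v : ∀ c → witness c ∈ home v - v
    witness∈home-v c = x∈p∧x≢y⇒x∈p-y (≺⇒∈-home (proj₁ (witness-spec c)))
                         (λ wc≡v → ≺-irrefl (subst (_≺ v) wc≡v (proj₁ (witness-spec c))))

  colour-proper : ∀ {u v} → u ≺ v → colour u ≢ colour v
  colour-proper {u} {v} u≺v cu≡cv with freeColour-free (earlier colour v)
  ... | inj₁ all-taken = not-all-taken v all-taken
  ... | inj₂ cv-free   = cv-free (u , (begin
    lookup (earlier colour v) u  ≡⟨ lookup-earlier colour u≺v ⟩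
    just (colour u)              ≡⟨ cong just cu≡cv ⟩
    just (colour v)              ≡⟨ cong just (recurse-unfold (λ _ → freeColour) v) ⟩
    just (freeColour (earlier colour v)) ∎))
    where open ≡-Reasoning

-- If every vertex has at most one earlier neighbour of each colour, the earlier-neighbour
-- graph between two colour classes is a forest, so its edges can be signed arbitrarily.
module Signing {n K ℓ} {_≺_ : Rel (Fin n) ℓ} (_≺?_ : Decidable _≺_)
  (≺-wf : WellFounded _≺_) (colour : Fin n → Fin K)
  (earlier-colour-injective : ∀ {u u′ v} → u ≺ v → u′ ≺ v → colour u ≡ colour u′ → u ≡ u′)
  (adj : Fin n → Fin n → Bool) where

  open CourseOfValues _≺?_ ≺-wf

  signStep : Fin n → Vec (Maybe (Fin K → Bool)) n → Fin K → Bool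
  signStep v σs c with FinP.any? (λ u → (u ≺? v) ×-dec (colour u FinP.≟ c))
  ... | yes (u , _) = maybe (λ σ → adj u v xor σ (colour v)) false (lookup σs u)
  ... | no _        = false

  signStep-≺ : ∀ {u v σs σ} → u ≺ v → lookup σs u ≡ just σ →
               signStep v σs (colour u) ≡ adj u v xor σ (colour v)
  signStep-≺ {u} {v} u≺v σs[u]≡σ with FinP.any? (λ w → (w ≺? v) ×-dec (colour w FinP.≟ colour u))
  ... | yes (w , w≺v , cw≡cu) rewrite earlier-colour-injective w≺v u≺v cw≡cu | σs[u]≡σ = refl
  ... | no ∄w = contradiction (u , u≺v , refl) ∄w

  sign : Fin n → Fin K → Bool
  sign = recurse signStep

  sign-≺ : ∀ {u v} → u ≺ v → sign v (colour u) ≡ adj u v xor sign u (colour v)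
  sign-≺ {u} {v} u≺v = trans (cong (λ σ → σ (colour u)) (recurse-unfold signStep v))
                             (signStep-≺ u≺v (lookup-earlier sign u≺v))

-- Label combine p j stands for the ordered pair of distinct colours (p , punchIn p j).
module PairLabels {k : ℕ} where

  Carries : Fin (suc k) → (Fin (suc k) → Bool) → Fin (suc k) → Fin (suc k) → Set
  Carries c σ p q = (c ≡ p × σ q ≡ true) ⊎ (c ≡ q × σ p ≡ false)

  carries? : ∀ c σ p q → Dec (Carries c σ p q)
  carries? c σ p q = ((c FinP.≟ p) ×-dec (σ q Bool.≟ true))
              ⊎-dec ((c FinP.≟ q) ×-dec (σ p Bool.≟ false))

  distinctPair : Fin (suc k) × Fin k → Fin (suc k) × Fin (suc k)
  distinctPair (p , j) = p , punchIn p j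

  pairOf : Fin (suc k * k) → Fin (suc k) × Fin (suc k)
  pairOf = distinctPair ∘ remQuot k

  labelOf : ∀ {p q : Fin (suc k)} → p ≢ q → Fin (suc k * k)
  labelOf {p} p≢q = combine p (punchOut p≢q)

  pairOf-labelOf : ∀ {p q : Fin (suc k)} (p≢q : p ≢ q) → pairOf (labelOf p≢q) ≡ (p , q)
  pairOf-labelOf {p} {q} p≢q = begin
    pairOf (labelOf p≢q)           ≡⟨ cong distinctPair (FinP.remQuot-combine p (punchOut p≢q)) ⟩
    (p , punchIn p (punchOut p≢q)) ≡⟨ cong (p ,_) (FinP.punchIn-punchOut p≢q) ⟩
    (p , q)                        ∎
    where open ≡-Reasoning

  labels : Fin (suc k) → (Fin (suc k) → Bool) → Subset (suc k * k)
  labels c σ = tabulate (does ∘ uncurry (carries? c σ) ∘ pairOf)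

  ∈-labels : ∀ {c σ ℓ} → ℓ ∈ labels c σ ⇔ uncurry (Carries c σ) (pairOf ℓ)
  ∈-labels {c} {σ} = ∈-tabulate-does (uncurry (carries? c σ) ∘ pairOf)

  labelOf∈labels : ∀ {c σ p q} (p≢q : p ≢ q) → Carries c σ p q → labelOf p≢q ∈ labels c σ
  labelOf∈labels {c} {σ} p≢q carries =
    Equivalence.from (∈-labels {c} {σ}) (subst (uncurry (Carries c σ)) (sym (pairOf-labelOf p≢q)) carries)

  carries-both⇒≢ : ∀ {c c′ σ σ′ p q} → c ≢ c′ → Carries c σ p q → Carries c′ σ′ p q → σ c′ ≢ σ′ c
  carries-both⇒≢ c≢c′ (inj₁ (refl , _))  (inj₁ (refl , _))  = contradiction refl c≢c′
  carries-both⇒≢ _    (inj₁ (refl , σq)) (inj₂ (refl , σ′p)) =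
    λ eq → contradiction (trans (sym σq) (trans eq σ′p)) λ ()
  carries-both⇒≢ _    (inj₂ (refl , σp)) (inj₁ (refl , σ′q)) =
    λ eq → contradiction (trans (sym σp) (trans eq σ′q)) λ ()
  carries-both⇒≢ c≢c′ (inj₂ (refl , _))  (inj₂ (refl , _))  = contradiction refl c≢c′

  labels-meet⇔ : ∀ {c c′ σ σ′} → c ≢ c′ → LabelsMeet (labels c σ) (labels c′ σ′) ⇔ σ c′ ≢ σ′ c
  labels-meet⇔ {c} {c′} {σ} {σ′} c≢c′ = mk⇔ to from
    where
    to : LabelsMeet (labels c σ) (labels c′ σ′) → σ c′ ≢ σ′ c
    to (ℓ , ℓ∈ , ℓ∈′) = carries-both⇒≢ c≢c′ (Equivalence.to (∈-labels {c} {σ}) ℓ∈)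
                                               (Equivalence.to (∈-labels {c′} {σ′}) ℓ∈′)

    from : σ c′ ≢ σ′ c → LabelsMeet (labels c σ) (labels c′ σ′)
    from σc′≢σ′c with σ c′ in σc′ | σ′ c in σ′c
    ... | true  | false = labelOf c≢c′ , labelOf∈labels {σ = σ} c≢c′ (inj₁ (refl , σc′))
                                       , labelOf∈labels {σ = σ′} c≢c′ (inj₂ (refl , σ′c))
    ... | false | true  = labelOf c′≢c , labelOf∈labels {σ = σ} c′≢c (inj₂ (refl , σc′))
                                       , labelOf∈labels {σ = σ′} c′≢c (inj₁ (refl , σ′c))
      where c′≢c = ≢-sym c≢c′
    ... | true  | true  = contradiction refl σc′≢σ′c
    ... | false | false = contradiction refl σc′≢σ′c

module Spans {G : Graph} (P : PathDecomposition G) where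

  SharedBag : Fin (n G) → Fin (n G) → Set
  SharedBag u v = ∃[ j ] u ∈ bag P j × v ∈ bag P j

  private
    firstBag : ∀ v → ∃[ i ] v ∈ bag P i × (∀ {j} → v ∈ bag P j → i Fin.≤ j)
    firstBag v = least (λ i → v ∈? bag P i) (covers-vtx P v)

    lastBag : ∀ v → ∃[ i ] v ∈ bag P i × (∀ {j} → v ∈ bag P j → j Fin.≤ i)
    lastBag v = greatest (λ i → v ∈? bag P i) (covers-vtx P v)

  first last : Fin (n G) → Fin (m P)
  first v = proj₁ (firstBag v)
  last  v = proj₁ (lastBag v)

  first-∈ : ∀ v → v ∈ bag P (first v)
  first-∈ v = proj₁ (proj₂ (firstBag v))

  first-≤ : ∀ {v j} → v ∈ bag P j → first v Fin.≤ j
  first-≤ {v} = proj₂ (proj₂ (firstBag v))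

  last-∈ : ∀ v → v ∈ bag P (last v)
  last-∈ v = proj₁ (proj₂ (lastBag v))

  ≤-last : ∀ {v j} → v ∈ bag P j → j Fin.≤ last v
  ≤-last {v} = proj₂ (proj₂ (lastBag v))

  ∈-bag : ∀ {v j} → first v Fin.≤ j → j Fin.≤ last v → v ∈ bag P j
  ∈-bag {v} {j} f≤j j≤l = contiguous P v (first v) j (last v) f≤j j≤l (first-∈ v) (last-∈ v)

  interval : Fin (n G) → OpenInterval
  interval v = ⟨ fromℕ (toℕ (first v)) , fromℕ (suc (toℕ (last v))) ,
                 fromℕ-mono-< (s≤s (first-≤ (last-∈ v))) ⟩

  ∈-interval : ∀ {v j q} → v ∈ bag P j → fromℕ (toℕ j) ℚ.< q → q ℚ.< fromℕ (suc (toℕ j)) →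
               q ∈ᵢ interval v
  ∈-interval v∈j j<q q<j+1 = ℚP.≤-<-trans (fromℕ-mono-≤ (first-≤ v∈j)) j<q
                           , ℚP.<-≤-trans q<j+1 (fromℕ-mono-≤ (s≤s (≤-last v∈j)))

  shared-bag-at-later-first : ∀ {u v} → first u Fin.≤ first v →
    fromℕ (toℕ (first v)) ℚ.< fromℕ (suc (toℕ (last u))) → SharedBag u v
  shared-bag-at-later-first {u} {v} fu≤fv fv<lu+1 =
    first v , ∈-bag fu≤fv (ℕP.≤-pred (fromℕ-cancel-< fv<lu+1)) , first-∈ v

  intervals-meet⇔shared-bag : ∀ {u v} → IntervalsMeet (interval u) (interval v) ⇔ SharedBag u v
  intervals-meet⇔shared-bag {u} {v} = mk⇔ to from
    where
    to : IntervalsMeet (interval u) (interval v) → SharedBag u v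
    to (q , (fu<q , q<lu+1) , (fv<q , q<lv+1)) with first u FinP.≤? first v
    ... | yes fu≤fv = shared-bag-at-later-first fu≤fv (ℚP.<-trans fv<q q<lu+1)
    ... | no  fu≰fv = map₂ swap (shared-bag-at-later-first (ℕP.<⇒≤ (ℕP.≰⇒> fu≰fv))
                                                           (ℚP.<-trans fu<q q<lv+1))

    from : SharedBag u v → IntervalsMeet (interval u) (interval v)
    from (j , u∈j , v∈j) with ℚP.<-dense (fromℕ-mono-< (ℕP.n<1+n (toℕ j)))
    ... | q , j<q , q<j+1 = q , ∈-interval u∈j j<q q<j+1 , ∈-interval v∈j j<q q<j+1

module _ {G : Graph} {k : ℕ} (P : PathDecomposition G) (width≤k : ∀ i → ∣ bag P i ∣ ≤ suc k) where

  open Spans P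

  key : Fin (n G) → Fin (m P * n G)
  key v = combine (first v) v

  _≺_ : Rel (Fin (n G)) _
  u ≺ v = key u Fin.< key v × u ∈ bag P (first v)

  _≺?_ : Decidable _≺_
  u ≺? v = (key u FinP.<? key v) ×-dec (u ∈? bag P (first v))

  ≺-wellFounded : WellFounded _≺_
  ≺-wellFounded = Subrelation.wellFounded proj₁ (On.wellFounded key FinI.<-wellFounded)

  key<⇒≺ : ∀ {u v j} → u ∈ bag P j → v ∈ bag P j → key u Fin.< key v → u ≺ v
  key<⇒≺ {u} {v} u∈j v∈j ku<kv = ku<kv , ∈-bag
    (ℕP.≮⇒≥ λ fv<fu → FinP.<-asym ku<kv (FinP.combine-monoˡ-< v u fv<fu))
    (FinP.≤-trans (first-≤ v∈j) (≤-last u∈j))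

  shared-bag⇒≺⊎≻ : ∀ {u v} → u ≢ v → SharedBag u v → u ≺ v ⊎ v ≺ u
  shared-bag⇒≺⊎≻ {u} {v} u≢v (j , u∈j , v∈j) with FinP.<-cmp (key u) (key v)
  ... | tri< ku<kv _ _ = inj₁ (key<⇒≺ u∈j v∈j ku<kv)
  ... | tri≈ _ ku≡kv _ = contradiction (FinP.combine-injectiveʳ (first u) u (first v) v ku≡kv) u≢v
  ... | tri> _ _ kv<ku = inj₂ (key<⇒≺ v∈j u∈j kv<ku)

  open GreedyColouring _≺?_ ≺-wellFounded (bag P ∘ first) first-∈ proj₂ (width≤k ∘ first)

  earlier-colour-injective : ∀ {u u′ v} → u ≺ v → u′ ≺ v → colour u ≡ colour u′ → u ≡ u′
  earlier-colour-injective {u} {u′} {v} u≺v u′≺v cu≡cu′ with u FinP.≟ u′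
  ... | yes u≡u′ = u≡u′
  ... | no u≢u′ with shared-bag⇒≺⊎≻ u≢u′ (first v , proj₂ u≺v , proj₂ u′≺v)
  ...   | inj₁ u≺u′ = contradiction cu≡cu′ (colour-proper u≺u′)
  ...   | inj₂ u′≺u = contradiction (sym cu≡cu′) (colour-proper u′≺u)

  open Signing _≺?_ ≺-wellFounded colour earlier-colour-injective (adj G)
  open PairLabels {k}

  labelling : Fin (n G) → Subset (suc k * k)
  labelling v = labels (colour v) (sign v)

  edge⇔labels-meet-≺ : ∀ {u v} → u ≺ v → Edge G u v ⇔ LabelsMeet (labelling u) (labelling v)
  edge⇔labels-meet-≺ {u} {v} u≺v =
    ⇔-sym (labels-meet⇔ {σ = sign u} {σ′ = sign v} (colour-proper u≺v)) ⇔-∘ xor⇒≡true⇔≢ (sign-≺ u≺v)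

  edge⇔labels-meet : ∀ {u v} → u ≢ v → SharedBag u v → Edge G u v ⇔ LabelsMeet (labelling u) (labelling v)
  edge⇔labels-meet {u} {v} u≢v shared with shared-bag⇒≺⊎≻ u≢v shared
  ... | inj₁ u≺v = edge⇔labels-meet-≺ u≺v
  ... | inj₂ v≺u = mk⇔ (map₂ swap) (map₂ swap) ⇔-∘ (edge⇔labels-meet-≺ v≺u ⇔-∘ edge-sym)
    where
    edge-sym : Edge G u v ⇔ Edge G v u
    edge-sym = mk⇔ (trans (adj-sym G v u)) (trans (adj-sym G u v))

  simIntervalRep : SimIntervalRep G (suc k * k)
  simIntervalRep = record { R = interval ; L = labelling ; correct = correct }
    where
    correct : ∀ u v → u ≢ v →
              Edge G u v ⇔ (IntervalsMeet (interval u) (interval v) × LabelsMeet (labelling u) (labelling v))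
    correct u v u≢v = mk⇔
      (λ uv → let shared = covers-edge P u v uv in
              Equivalence.from intervals-meet⇔shared-bag shared ,
              Equivalence.to (edge⇔labels-meet u≢v shared) uv)
      (λ (meet , labels-meet) →
              Equivalence.from (edge⇔labels-meet u≢v (Equivalence.to intervals-meet⇔shared-bag meet)) labels-meet)

theorem19 : (G : Graph) (k : ℕ) → IsPathwidth G k → si≤ G (k * k + k)
theorem19 G k ((P , width≤k) , _) = suc k * k , ℕP.≤-reflexive (ℕP.+-comm k (k * k)) , simIntervalRep P width≤k
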